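{- Let $k\ge 3$ be an integer. Given a (fully) dynamic bounded $k$-sum instance with weight threshold $\mathsf{r}_{\mathsf{max}}$, there is a (fully) dynamic subset sum instance with the same number of items and target threshold $\mathsf{t}_{\mathsf{max}} \le O(k^{k+2}\mathsf{r}_{\mathsf{max}})$ that preserves the query results. More precisely, each insertion (resp. deletion) of a number into (resp. from) a set $\mathsf{A}_i$ corresponds to the insertion (resp. deletion) of one item, and each bounded $k$-sum query corresponds to a subset sum query with a target $t\le \mathsf{t}_{\mathsf{max}}$, such that the answer to each subset sum query equals the answer to the corresponding bounded $k$-sum query.
   Context: (Fully) dynamic bounded $k$-sum: an integer bound $\mathsf{r}_{\mathsf{max}}$ is given in advance; sets $\mathsf{A}_1,\dots,\mathsf{A}_k$ of integers in $[0,\mathsf{r}_{\mathsf{max}}]$ are initially empty; operations insert an integer in $[0,\mathsf{r}_{\mathsf{max}}]$ into some $\mathsf{A}_i$, (in the fully dynamic version) delete a present number from some $\mathsf{A}_i$, or query whether there exist $a_i\in\mathsf{A}_i$ ($1\le i\le k$) with $a_1+\dots+a_{k-1}=a_k$. (Fully) dynamic subset sum: a target threshold $\mathsf{t}_{\mathsf{max}}$ is given in advance; a multiset of items with non-negative integer weights is initially empty; operations insert an item, (in the fully dynamic version) delete a present item, or query, for a given $0\le t\le \mathsf{t}_{\mathsf{max}}$, whether some sub-multiset of the current items has weights summing to exactly $t$. -}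

module Defs where

open import Data.Nat using (ℕ; suc; _≤_)
open import Data.Fin using (Fin; fromℕ; inject₁)
open import Data.List using (List; map; allFin)
open import Data.Nat.ListAction using (sum)
open import Data.List.Membership.Propositional using (_∈_)
open import Data.List.Relation.Unary.All using (All)
open import Data.List.Relation.Unary.Unique.Propositional using (Unique)
open import Data.List.Relation.Binary.Sublist.Propositional using (_⊆_)
open import Data.Product using (Σ; _×_; _,_; proj₂)
open import Relation.Binary.PropositionalEquality using (_≡_)

-- A state of a (fully) dynamic bounded k-sum instance with k = suc n:
-- the sets A_1..A_k are encoded as a list of pairs (i , a) meaning a ∈ A_i.
-- Index i : Fin (suc n); the "last" set A_k is index fromℕ n, and
-- A_1..A_{k-1} are the indices inject₁ j for j : Fin n.
KState : ℕ → Set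
KState n = List (Fin (suc n) × ℕ)

ValidKState : (n rmax : ℕ) → KState n → Set
ValidKState n rmax S = Unique S × All (λ p → proj₂ p ≤ rmax) S

KSumYes : (n : ℕ) → KState n → Set
KSumYes n S =
  Σ (Fin (suc n) → ℕ) λ a →
    ((i : Fin (suc n)) → (i , a i) ∈ S) ×
    (sum (map (λ j → a (inject₁ j)) (allFin n)) ≡ a (fromℕ n))

SubsetSumYes : List ℕ → ℕ → Set
SubsetSumYes ws t = Σ (List ℕ) λ ys → (ys ⊆ ws) × (sum ys ≡ t)

items : {n : ℕ} → (Fin (suc n) → ℕ → ℕ) → KState n → List ℕ
items w S = map (λ p → w (Data.Product.proj₁ p) (proj₂ p)) S

-- Give a number a of the set A_i the weight W + M·k^i + e_i(a), where e_i(a) = a for i < k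
-- and e_k(a) = r − a, and take the target t = k·W + M·(1 + k + ⋯ + k^(k−1)) + r. The three
-- parts live on separate scales: for at most k items the offsets sum to less than M and the
-- M-part plus offsets to less than W. So a sub-multiset of weight t has exactly k items, the
-- sum of k^i over their indices is 1 + k + ⋯ + k^(k−1) with only k terms, which forces one
-- item from each set, and their offsets sum to r, i.e. a_1 + ⋯ + a_(k−1) = a_k. With
-- M = k(r+1) and W = (k^k + 1)M the target stays below 4 k^(k+2) (r+1).
module Submission where

open import Defs
open import Data.Nat using (ℕ; zero; suc; _+_; _*_; _^_; _∸_; _≤_; _<_; _≤?_; z≤n; s≤s; NonZero)
open import Data.Nat.Properties hiding (_≟_)
open import Data.Nat.Properties using () renaming (_≟_ to _≟ℕ_)
open import Data.Nat.Solver using (module +-*-Solver)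
open +-*-Solver using (solve; _:+_; _:*_; _:^_; _:=_; con)
open import Data.Nat.DivMod using (_%_; [m+kn]%n≡m%n; m<n⇒m%n≡m)
open import Data.Nat.ListAction using (sum)
open import Data.Bool using (if_then_else_)
open import Data.Fin using (Fin; zero; suc; toℕ; fromℕ; inject₁)
open import Data.Fin.Properties using (_≟_; toℕ≤pred[n])
open import Data.List using (List; []; _∷_; [_]; map; length; filter; allFin; tabulate)
open import Data.List.Properties using (map-tabulate)
open import Data.List.Relation.Unary.All as All using (All; []; _∷_)
open import Data.List.Relation.Unary.All.Properties using (all-filter) renaming (filter⁺ to All-filter⁺)
open import Data.List.Relation.Unary.AllPairs using (_∷_)
open import Data.List.Relation.Unary.Any using (here)
open import Data.List.Relation.Unary.Unique.Propositional using (Unique)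
open import Data.List.Relation.Unary.Unique.Propositional.Properties using () renaming (filter⁺ to Unique-filter⁺)
open import Data.List.Membership.Propositional using (_∈_)
open import Data.List.Relation.Binary.Sublist.Propositional using (_⊆_; []; _∷_; _∷ʳ_)
open import Data.List.Relation.Binary.Sublist.Propositional.Properties using (map⁺; filter-⊆; All-resp-⊆; Any-resp-⊆)
open import Data.List.Membership.Propositional.Properties using (∈-filter⁺; ∈-filter⁻)
open import Data.Product using (Σ; ∃; _×_; _,_; proj₁; proj₂; map₁)
open import Function using (_∘_; id)
open import Relation.Nullary using (does; yes; no; contradiction)
open import Relation.Unary using (Decidable)
open import Relation.Binary using (DecidableEquality)
open import Function.Bundles using (_⇔_; mk⇔; Equivalence)
open import Relation.Binary.PropositionalEquality using (_≡_; refl; sym; trans; cong; cong₂; subst; module ≡-Reasoning)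
open import Algebra.Properties.CommutativeSemigroup +-commutativeSemigroup using (interchange)
open import Algebra.Properties.CommutativeSemigroup *-commutativeSemigroup using (x∙yz≈y∙xz)
open import Algebra.Properties.Semiring.Sum +-*-semiring
  using (sum-syntax; sum-cong-≗; *-distribˡ-sum; ∑-distrib-+; sum-replicate-zero; sum-init-last)

private
  variable
    A B : Set

sum-map-+ : (f g : A → ℕ) (xs : List A) →
            sum (map (λ x → f x + g x) xs) ≡ sum (map f xs) + sum (map g xs)
sum-map-+ f g [] = refl
sum-map-+ f g (x ∷ xs) =
  trans (cong (f x + g x +_) (sum-map-+ f g xs)) (interchange (f x) (g x) _ _)

sum-map-*ʳ : (f : A → ℕ) (c : ℕ) (xs : List A) →
             sum (map (λ x → f x * c) xs) ≡ sum (map f xs) * c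
sum-map-*ʳ f c [] = refl
sum-map-*ʳ f c (x ∷ xs) =
  trans (cong (f x * c +_) (sum-map-*ʳ f c xs)) (sym (*-distribʳ-+ c (f x) _))

sum-map-const : {f : A → ℕ} {c : ℕ} {xs : List A} →
                All (λ x → f x ≡ c) xs → sum (map f xs) ≡ length xs * c
sum-map-const [] = refl
sum-map-const (refl ∷ eqs) = cong (_ +_) (sum-map-const eqs)

sum-map-≤ : {f : A → ℕ} {c : ℕ} {xs : List A} →
            All (λ x → f x ≤ c) xs → sum (map f xs) ≤ length xs * c
sum-map-≤ [] = z≤n
sum-map-≤ (le ∷ les) = +-mono-≤ le (sum-map-≤ les)

sum-map-allFin : ∀ n (f : Fin n → ℕ) → sum (map f (allFin n)) ≡ ∑[ j < n ] f j
sum-map-allFin n f = trans (cong sum (map-tabulate id f)) (sum-tabulate f)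
  where
  sum-tabulate : ∀ {m} (g : Fin m → ℕ) → sum (tabulate g) ≡ ∑[ j < m ] g j
  sum-tabulate {zero} g = refl
  sum-tabulate {suc m} g = cong (g zero +_) (sum-tabulate (g ∘ suc))

∑-const : ∀ n c → ∑[ j < n ] c ≡ n * c
∑-const zero c = refl
∑-const (suc n) c = cong (c +_) (∑-const n c)

∑-≤ : ∀ {n} {f : Fin n → ℕ} {c} → (∀ j → f j ≤ c) → ∑[ j < n ] f j ≤ n * c
∑-≤ {zero} le = z≤n
∑-≤ {suc n} le = +-mono-≤ (le zero) (∑-≤ (le ∘ suc))

∑-indicator : ∀ {n} (i : Fin n) v → ∑[ j < n ] (if does (i ≟ j) then v else 0) ≡ v
∑-indicator {suc n} zero v = trans (cong (v +_) (sum-replicate-zero n)) (+-identityʳ v)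
∑-indicator (suc i) v = ∑-indicator i v

∑-*ʳ : ∀ {n} (f : Fin n → ℕ) c → ∑[ j < n ] (f j * c) ≡ (∑[ j < n ] f j) * c
∑-*ʳ {zero} f c = refl
∑-*ʳ {suc n} f c = trans (cong (f zero * c +_) (∑-*ʳ (f ∘ suc) c)) (sym (*-distribʳ-+ c (f zero) _))

divMod-unique : ∀ d .{{_ : NonZero d}} {r₁ r₂ q₁ q₂} → r₁ < d → r₂ < d →
                r₁ + q₁ * d ≡ r₂ + q₂ * d → r₁ ≡ r₂ × q₁ ≡ q₂
divMod-unique d {r₁} {r₂} {q₁} {q₂} r₁<d r₂<d eq = r₁≡r₂ , q₁≡q₂
  where
  open ≡-Reasoning
  r₁≡r₂ : r₁ ≡ r₂
  r₁≡r₂ = begin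
    r₁                ≡⟨ m<n⇒m%n≡m r₁<d ⟨
    r₁ % d            ≡⟨ [m+kn]%n≡m%n r₁ q₁ d ⟨
    (r₁ + q₁ * d) % d ≡⟨ cong (_% d) eq ⟩
    (r₂ + q₂ * d) % d ≡⟨ [m+kn]%n≡m%n r₂ q₂ d ⟩
    r₂ % d            ≡⟨ m<n⇒m%n≡m r₂<d ⟩
    r₂                ∎
  q₁≡q₂ : q₁ ≡ q₂
  q₁≡q₂ = *-cancelʳ-≡ q₁ q₂ d (+-cancelˡ-≡ r₁ _ _ (trans eq (cong (_+ q₂ * d) (sym r₁≡r₂))))

repunit-unique : ∀ {b m} → 1 < b → (c : Fin m → ℕ) → ∑[ j < m ] c j ≤ b →
                 ∑[ j < m ] (c j * b ^ toℕ j) ≡ ∑[ j < m ] (b ^ toℕ j) → ∀ j → c j ≡ 1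
repunit-unique {b} {suc m} 1<b@(s≤s (s≤s _)) c ∑c≤b eq = digit
  where
  shift : ∀ (f : Fin m → ℕ) → ∑[ j < m ] (b * f j) ≡ (∑[ j < m ] f j) * b
  shift f = trans (sym (*-distribˡ-sum b f)) (*-comm b (∑[ j < m ] f j))
  c₀ X Y : ℕ
  c₀ = c zero
  X = ∑[ j < m ] (c (suc j) * b ^ toℕ j)
  Y = ∑[ j < m ] (b ^ toℕ j)
  split : c₀ + X * b ≡ 1 + Y * b
  split = begin
    c₀ + X * b
      ≡⟨ cong₂ _+_ (*-identityʳ c₀) (shift _) ⟨
    c₀ * 1 + ∑[ j < m ] (b * (c (suc j) * b ^ toℕ j))
      ≡⟨ cong (c₀ * 1 +_) (sum-cong-≗ λ j → x∙yz≈y∙xz b (c (suc j)) _) ⟩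
    ∑[ j < suc m ] (c j * b ^ toℕ j)
      ≡⟨ eq ⟩
    ∑[ j < suc m ] (b ^ toℕ j)
      ≡⟨ cong (1 +_) (shift _) ⟩
    1 + Y * b
      ∎
    where open ≡-Reasoning
  -- c₀ ≡ 1 modulo b and c₀ ≤ b leave only c₀ = 1.
  low : c₀ ≡ 1 × X ≡ Y
  low with c₀ | m+n≤o⇒m≤o c₀ ∑c≤b | split
  ... | zero  | _   | eq = contradiction (proj₁ (divMod-unique b {q₁ = X} {q₂ = Y} (s≤s z≤n) 1<b eq)) λ ()
  ... | suc d | d<b | eq = map₁ (cong suc) (divMod-unique b {q₁ = X} {q₂ = Y} d<b (s≤s z≤n) (suc-injective eq))
  digit : ∀ j → c j ≡ 1
  digit zero = proj₁ low
  digit (suc j) = repunit-unique 1<b (c ∘ suc) (m+n≤o⇒n≤o c₀ ∑c≤b) (proj₂ low) j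

unique-singleton : ∀ {x : A} {xs} → Unique xs → All (_≡ x) xs → x ∈ xs → xs ≡ [ x ]
unique-singleton (_ ∷ _) (refl ∷ []) _ = refl
unique-singleton ((y≢z ∷ _) ∷ _) (refl ∷ refl ∷ _) _ = contradiction refl y≢z

singleton-with : ∀ {P : A → Set} {xs} → All P xs → length xs ≡ 1 → ∃ λ y → P y × xs ≡ [ y ]
singleton-with (py ∷ []) refl = _ , py , refl

⊆-map⁻ : (f : A → B) {ys : List B} (xs : List A) → ys ⊆ map f xs → ∃ λ L → L ⊆ xs × ys ≡ map f L
⊆-map⁻ f [] [] = [] , [] , refl
⊆-map⁻ f (x ∷ xs) (_ ∷ʳ ys⊆) with ⊆-map⁻ f xs ys⊆
... | L , L⊆ , refl = L , x ∷ʳ L⊆ , refl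
⊆-map⁻ f (x ∷ xs) (refl ∷ ys⊆) with ⊆-map⁻ f xs ys⊆
... | L , L⊆ , refl = x ∷ L , refl ∷ L⊆ , refl

module _ {A : Set} {K : ℕ} where

  slice : Fin K → List (Fin K × A) → List (Fin K × A)
  slice j = filter (λ x → proj₁ x ≟ j)

  sum-map-slice-∷ : (f : Fin K × A → ℕ) (j : Fin K) (x : Fin K × A) (L : List (Fin K × A)) →
    sum (map f (slice j (x ∷ L))) ≡ (if does (proj₁ x ≟ j) then f x else 0) + sum (map f (slice j L))
  sum-map-slice-∷ f j x L with proj₁ x ≟ j
  ... | yes _ = refl
  ... | no  _ = refl

  sum-map-slices : (f : Fin K × A → ℕ) (L : List (Fin K × A)) →
                   sum (map f L) ≡ ∑[ j < K ] sum (map f (slice j L))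
  sum-map-slices f [] = sym (sum-replicate-zero K)
  sum-map-slices f (x ∷ L) = begin
    f x + sum (map f L)
      ≡⟨ cong₂ _+_ (sym (∑-indicator (proj₁ x) (f x))) (sum-map-slices f L) ⟩
    ∑[ j < K ] (if does (proj₁ x ≟ j) then f x else 0) + ∑[ j < K ] sum (map f (slice j L))
      ≡⟨ ∑-distrib-+ (λ j → if does (proj₁ x ≟ j) then f x else 0) (λ j → sum (map f (slice j L))) ⟨
    ∑[ j < K ] ((if does (proj₁ x ≟ j) then f x else 0) + sum (map f (slice j L)))
      ≡⟨ sum-cong-≗ (λ j → sum-map-slice-∷ f j x L) ⟨
    ∑[ j < K ] sum (map f (slice j (x ∷ L)))
      ∎
    where open ≡-Reasoning

  length-slices : (L : List (Fin K × A)) → length L ≡ ∑[ j < K ] length (slice j L)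
  length-slices L =
    trans (sym (sum-map-1 L)) (trans (sum-map-slices (λ _ → 1) L) (sum-cong-≗ λ j → sum-map-1 (slice j L)))
    where
    sum-map-1 : ∀ (xs : List (Fin K × A)) → sum (map (λ _ → 1) xs) ≡ length xs
    sum-map-1 [] = refl
    sum-map-1 (_ ∷ xs) = cong suc (sum-map-1 xs)

  Picks : List (Fin K × A) → (Fin K → A) → Set
  Picks L a = ∀ j → slice j L ≡ [ (j , a j) ]

  sum-map-picks : ∀ (f : Fin K × A → ℕ) L {a} → Picks L a → sum (map f L) ≡ ∑[ j < K ] f (j , a j)
  sum-map-picks f L picks =
    trans (sum-map-slices f L) (sum-cong-≗ λ j → trans (cong (sum ∘ map f) (picks j)) (+-identityʳ _))

  picks-∈ : ∀ {L a} → Picks L a → ∀ j → (j , a j) ∈ L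
  picks-∈ picks j = proj₁ (∈-filter⁻ (λ x → proj₁ x ≟ j) (subst (_ ∈_) (sym (picks j)) (here refl)))

  picks-of-counts : ∀ L → (∀ j → length (slice j L) ≡ 1) → ∃ λ a → Picks L a
  picks-of-counts L one = proj₁ ∘ pick , proj₂ ∘ pick
    where
    pick : ∀ j → Σ A λ v → slice j L ≡ [ (j , v) ]
    pick j with singleton-with (all-filter (λ x → proj₁ x ≟ j) L) (one j)
    ... | (_ , v) , refl , eq = v , eq

  module _ (_≟ᴬ_ : DecidableEquality A) (a : Fin K → A) where

    OnGraph : Fin K × A → Set
    OnGraph x = proj₂ x ≡ a (proj₁ x)

    onGraph? : Decidable OnGraph
    onGraph? x = proj₂ x ≟ᴬ a (proj₁ x)

    onGraph-at : ∀ {j x} → proj₁ x ≡ j × OnGraph x → x ≡ (j , a j)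
    onGraph-at (refl , refl) = refl

    picks-filter : ∀ {S} → Unique S → (∀ j → (j , a j) ∈ S) → Picks (filter onGraph? S) a
    picks-filter {S} uniq mem j =
      unique-singleton (Unique-filter⁺ _ (Unique-filter⁺ onGraph? uniq))
                       (All.zipWith onGraph-at (all-filter _ (filter onGraph? S) , All-filter⁺ _ (all-filter onGraph? S)))
                       (∈-filter⁺ _ (∈-filter⁺ onGraph? (mem j) refl) refl)

-- Truncation in r ∸ a never happens on valid states, where a ≤ r.
offset : ∀ {n} → ℕ → Fin (suc n) → ℕ → ℕ
offset {zero}  r zero    a = r ∸ a
offset {suc n} r zero    a = a
offset {suc n} r (suc i) a = offset r i a

offset-fromℕ : ∀ n r a → offset r (fromℕ n) a ≡ r ∸ a
offset-fromℕ zero    r a = refl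
offset-fromℕ (suc n) r a = offset-fromℕ n r a

offset-inject₁ : ∀ {n} r (j : Fin n) a → offset r (inject₁ j) a ≡ a
offset-inject₁ r zero    a = refl
offset-inject₁ r (suc j) a = offset-inject₁ r j a

offset-≤ : ∀ {n r a} (i : Fin (suc n)) → a ≤ r → offset r i a ≤ r
offset-≤ {zero} {r} {a} zero a≤r = m∸n≤m r a
offset-≤ {suc n} zero    a≤r = a≤r
offset-≤ {suc n} (suc i) a≤r = offset-≤ i a≤r

∑-offset≡r⇔ksum : ∀ n r (a : Fin (suc n) → ℕ) → a (fromℕ n) ≤ r →
  (∑[ j < suc n ] offset r j (a j) ≡ r) ⇔ (∑[ j < n ] a (inject₁ j) ≡ a (fromℕ n))
∑-offset≡r⇔ksum n r a aₖ≤r = mk⇔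
  (λ eq → +-cancelʳ-≡ (r ∸ aₖ) _ _ (trans (sym ∑-offset) (trans eq (sym (m+[n∸m]≡n aₖ≤r)))))
  (λ eq → trans ∑-offset (trans (cong (_+ (r ∸ aₖ)) eq) (m+[n∸m]≡n aₖ≤r)))
  where
  aₖ = a (fromℕ n)
  ∑-offset : ∑[ j < suc n ] offset r j (a j) ≡ ∑[ j < n ] a (inject₁ j) + (r ∸ aₖ)
  ∑-offset = trans (sum-init-last (λ j → offset r j (a j)))
                   (cong₂ _+_ (sum-cong-≗ λ j → offset-inject₁ r j (a (inject₁ j))) (offset-fromℕ n r aₖ))

module Encoding (n r : ℕ) where

  k P M W G : ℕ
  k = suc n
  P = k ^ n
  M = k * suc r
  W = suc (k * P) * M
  G = ∑[ j < k ] (k ^ toℕ j)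

  weight : Fin k → ℕ → ℕ
  weight i a = (offset r i a + k ^ toℕ i * M) + W

  target : ℕ
  target = (r + G * M) + k * W

  weight′ offset′ digit′ : Fin k × ℕ → ℕ
  weight′ x = weight (proj₁ x) (proj₂ x)
  offset′ x = offset r (proj₁ x) (proj₂ x)
  digit′ x = k ^ toℕ (proj₁ x)

  digit-≤ : ∀ (i : Fin k) → k ^ toℕ i ≤ P
  digit-≤ i = ^-monoʳ-≤ k (toℕ≤pred[n] i)

  below-M : ∀ {e} → e ≤ k * r → e < M
  below-M e≤ = ≤-<-trans e≤ (*-monoʳ-< k (n<1+n r))

  below-W : ∀ {e q} → e ≤ k * r → q ≤ k * P → e + q * M < W
  below-W e≤ q≤ = +-mono-<-≤ (below-M e≤) (*-monoˡ-≤ M q≤)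

  r≤kr : r ≤ k * r
  r≤kr = m≤n*m r k

  G≤kP : G ≤ k * P
  G≤kP = ∑-≤ digit-≤

  target-< : target < suc k * W
  target-< = +-monoˡ-< (k * W) (below-W r≤kr G≤kP)

  sum-weights : ∀ L → sum (map weight′ L) ≡ (sum (map offset′ L) + sum (map digit′ L) * M) + length L * W
  sum-weights L = begin
    sum (map weight′ L)
      ≡⟨ sum-map-+ (λ x → offset′ x + digit′ x * M) (λ _ → W) L ⟩
    sum (map (λ x → offset′ x + digit′ x * M) L) + sum (map (λ _ → W) L)
      ≡⟨ cong₂ _+_ (sum-map-+ offset′ (λ x → digit′ x * M) L) (sum-map-const (All.universal (λ _ → refl) L)) ⟩
    (sum (map offset′ L) + sum (map (λ x → digit′ x * M) L)) + length L * W
      ≡⟨ cong (λ z → (sum (map offset′ L) + z) + length L * W) (sum-map-*ʳ digit′ M L) ⟩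
    (sum (map offset′ L) + sum (map digit′ L) * M) + length L * W
      ∎
    where open ≡-Reasoning

  sum-weights-picks : ∀ L {a} → Picks L a → sum (map weight′ L) ≡ (∑[ j < k ] offset r j (a j) + G * M) + k * W
  sum-weights-picks L {a} picks = begin
    sum (map weight′ L)
      ≡⟨ sum-map-picks weight′ L picks ⟩
    ∑[ j < k ] ((offset r j (a j) + k ^ toℕ j * M) + W)
      ≡⟨ ∑-distrib-+ (λ j → offset r j (a j) + k ^ toℕ j * M) (λ _ → W) ⟩
    ∑[ j < k ] (offset r j (a j) + k ^ toℕ j * M) + ∑[ j < k ] W
      ≡⟨ cong₂ _+_ (∑-distrib-+ (λ j → offset r j (a j)) (λ j → k ^ toℕ j * M)) (∑-const k W) ⟩
    (∑[ j < k ] offset r j (a j) + ∑[ j < k ] (k ^ toℕ j * M)) + k * W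
      ≡⟨ cong (λ z → (∑[ j < k ] offset r j (a j) + z) + k * W) (∑-*ʳ (λ (j : Fin k) → k ^ toℕ j) M) ⟩
    (∑[ j < k ] offset r j (a j) + G * M) + k * W
      ∎
    where open ≡-Reasoning

  sum-digits-by-index : ∀ L → sum (map digit′ L) ≡ ∑[ j < k ] (length (slice j L) * k ^ toℕ j)
  sum-digits-by-index L = trans (sum-map-slices digit′ L)
    (sum-cong-≗ λ j → sum-map-const (All.map (cong (λ i → k ^ toℕ i)) (all-filter (λ x → proj₁ x ≟ j) L)))

  length-≤ : ∀ L → sum (map weight′ L) ≡ target → length L ≤ k
  length-≤ L eq with length L ≤? k
  ... | yes N≤k = N≤k
  ... | no  N≰k = contradiction eq (>⇒≢ (<-≤-trans target-< (begin
    suc k * W                                                      ≤⟨ *-monoˡ-≤ W (≰⇒> N≰k) ⟩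
    length L * W                                                   ≤⟨ m≤n+m (length L * W) _ ⟩
    (sum (map offset′ L) + sum (map digit′ L) * M) + length L * W  ≡⟨ sum-weights L ⟨
    sum (map weight′ L)                                            ∎)))
    where open ≤-Reasoning

  picks-of-target : 1 < k → ∀ {L} → All (λ x → proj₂ x ≤ r) L → sum (map weight′ L) ≡ target → ∃ λ a → Picks L a
  picks-of-target 1<k {L} bounded eq = picks-of-counts L one
    where
    N≤k : length L ≤ k
    N≤k = length-≤ L eq
    E≤ : sum (map offset′ L) ≤ k * r
    E≤ = ≤-trans (sum-map-≤ (All.map (λ {x} → offset-≤ (proj₁ x)) bounded)) (*-monoˡ-≤ r N≤k)
    Q≤ : sum (map digit′ L) ≤ k * P
    Q≤ = ≤-trans (sum-map-≤ (All.universal (digit-≤ ∘ proj₁) L)) (*-monoˡ-≤ P N≤k)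
    levels : sum (map offset′ L) + sum (map digit′ L) * M ≡ r + G * M × length L ≡ k
    levels = divMod-unique W (below-W E≤ Q≤) (below-W r≤kr G≤kP) (trans (sym (sum-weights L)) eq)
    digits : sum (map digit′ L) ≡ G
    digits = proj₂ (divMod-unique M (below-M E≤) (below-M r≤kr) (proj₁ levels))
    one : ∀ j → length (slice j L) ≡ 1
    one = repunit-unique 1<k (λ j → length (slice j L))
            (≤-reflexive (trans (sym (length-slices L)) (proj₂ levels)))
            (trans (sym (sum-digits-by-index L)) digits)

  subsetSum⇒ksum : 1 < k → (S : KState n) → ValidKState n r S →
                   SubsetSumYes (items weight S) target → KSumYes n S
  subsetSum⇒ksum 1<k S (_ , bounded) (ys , ys⊆ , eq) with ⊆-map⁻ weight′ S ys⊆
  ... | L , L⊆S , refl with picks-of-target 1<k (All-resp-⊆ L⊆S bounded) eq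
  ... | a , picks = a , a∈S , trans (sum-map-allFin n (a ∘ inject₁)) (Equivalence.to ksum⇔ ∑-offset≡r)
    where
    a∈S : ∀ j → (j , a j) ∈ S
    a∈S j = Any-resp-⊆ L⊆S (picks-∈ picks j)
    ksum⇔ : (∑[ j < k ] offset r j (a j) ≡ r) ⇔ (∑[ j < n ] a (inject₁ j) ≡ a (fromℕ n))
    ksum⇔ = ∑-offset≡r⇔ksum n r a (All.lookup bounded (a∈S (fromℕ n)))
    ∑-offset≡r : ∑[ j < k ] offset r j (a j) ≡ r
    ∑-offset≡r = +-cancelʳ-≡ (G * M) _ _ (+-cancelʳ-≡ (k * W) _ _ (trans (sym (sum-weights-picks L picks)) eq))

  ksum⇒subsetSum : (S : KState n) → ValidKState n r S →
                   KSumYes n S → SubsetSumYes (items weight S) target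
  ksum⇒subsetSum S (unique , bounded) (a , a∈S , ksum) =
    map weight′ L , map⁺ weight′ (filter-⊆ (onGraph? _≟ℕ_ a) S) , (begin
      sum (map weight′ L)                              ≡⟨ sum-weights-picks L (picks-filter _≟ℕ_ a unique a∈S) ⟩
      (∑[ j < k ] offset r j (a j) + G * M) + k * W    ≡⟨ cong (λ z → (z + G * M) + k * W) ∑-offset≡r ⟩
      target                                           ∎)
    where
    open ≡-Reasoning
    L = filter (onGraph? _≟ℕ_ a) S
    ∑-offset≡r : ∑[ j < k ] offset r j (a j) ≡ r
    ∑-offset≡r = Equivalence.from (∑-offset≡r⇔ksum n r a (All.lookup bounded (a∈S (fromℕ n))))
                   (trans (sym (sum-map-allFin n (a ∘ inject₁))) ksum)

  target-≤ : target ≤ 4 * k ^ (suc n + 2) * (r + 1)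
  target-≤ = begin
    target                         <⟨ target-< ⟩
    suc k * W                      ≤⟨ *-mono-≤ (+-monoˡ-≤ k {1} {k} (s≤s z≤n)) (*-monoˡ-≤ M (+-monoˡ-≤ (k * P) {1} {k * P} (m^n>0 k (suc n)))) ⟩
    (k + k) * ((k * P + k * P) * M) ≡⟨ solve 3 (λ k P r → (k :+ k) :* ((k :* P :+ k :* P) :* (k :* (con 1 :+ r)))
                                                  := con 4 :* (k :* P :* (k :^ 2)) :* (r :+ con 1)) refl k P r ⟩
    4 * (k * P * k ^ 2) * (r + 1)  ≡⟨ cong (λ z → 4 * z * (r + 1)) (^-distribˡ-+-* k (suc n) 2) ⟨
    4 * k ^ (suc n + 2) * (r + 1)  ∎
    where open ≤-Reasoning

theorem6 : Σ ℕ λ c → (n : ℕ) → 3 ≤ suc n → (rmax : ℕ) →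
  Σ (Fin (suc n) → ℕ → ℕ) λ w → Σ ℕ λ t →
    (t ≤ c * (suc n) ^ (suc n + 2) * (rmax + 1)) ×
    ((S : KState n) → ValidKState n rmax S →
      (KSumYes n S ⇔ SubsetSumYes (items w S) t))
theorem6 = 4 , λ n 2<k r → let open Encoding n r in
  weight , target , target-≤ ,
  λ S valid → mk⇔ (ksum⇒subsetSum S valid) (subsetSum⇒ksum (<⇒≤ 2<k) S valid)
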